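{- Let $M=(E,\mathcal{I})$ be a matroid with $\sigma(M)=k$. Then for any cocircuit $C$ of $M$ with $|C|=k$ and $C\neq E$, we have $\sigma(M\setminus C)\ge k$.
   Context: $\sigma(M)$ is the largest number of pairwise disjoint bases of $M$. A cocircuit is a minimal subset of $E$ meeting every base of $M$. $M\setminus C$ is the deletion of $C$: ground set $E\setminus C$ and independent sets $\{I\setminus C: I\in\mathcal{I}\}$. -}

module Defs where

open import Data.Nat using (ℕ; _<_; _≤_; _≥_)
open import Data.Fin using (Fin)
open import Data.Fin.Subset
  using (Subset; _∈_; _∉_; _⊆_; _∩_; _∪_; _─_; ∣_∣; ⁅_⁆; Nonempty; ⊥)
open import Data.Product using (Σ; ∃; _×_; _,_)
open import Data.Vec using (Vec; lookup)
open import Relation.Binary.PropositionalEquality using (_≡_)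
open import Relation.Nullary using (¬_)

record SetSystem (n : ℕ) : Set₁ where
  field
    ground : Subset n
    Indep  : Subset n → Set

open SetSystem public

record IsMatroid {n : ℕ} (M : SetSystem n) : Set where
  field
    indep⊆ground : ∀ I → Indep M I → I ⊆ ground M
    indep-empty  : Indep M ⊥
    indep-hered  : ∀ I J → Indep M J → I ⊆ J → Indep M I
    indep-aug    : ∀ I J → Indep M I → Indep M J → ∣ I ∣ < ∣ J ∣ →
                   ∃ λ x → x ∈ J × x ∉ I × Indep M (I ∪ ⁅ x ⁆)

record Matroid (n : ℕ) : Set₁ where
  field
    system   : SetSystem n
    isMatroid : IsMatroid system

open Matroid public

IsBase : {n : ℕ} → SetSystem n → Subset n → Set
IsBase M B = Indep M B × (∀ I → Indep M I → B ⊆ I → I ≡ B)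

HasDisjointBases : {n : ℕ} → SetSystem n → ℕ → Set
HasDisjointBases M m =
  Σ (Vec _ m) λ Bs →
    (∀ i → IsBase M (lookup Bs i)) ×
    (∀ i j → ¬ (i ≡ j) → (lookup Bs i ∩ lookup Bs j) ≡ ⊥)

σ≡ : {n : ℕ} → SetSystem n → ℕ → Set
σ≡ M k = HasDisjointBases M k × (∀ m → HasDisjointBases M m → m ≤ k)

σ≥ : {n : ℕ} → SetSystem n → ℕ → Set
σ≥ M k = ∃ λ m → m ≥ k × HasDisjointBases M m

MeetsAllBases : {n : ℕ} → SetSystem n → Subset n → Set
MeetsAllBases M C = ∀ B → IsBase M B → Nonempty (C ∩ B)

IsCocircuit : {n : ℕ} → SetSystem n → Subset n → Set
IsCocircuit M C =
  C ⊆ ground M × MeetsAllBases M C ×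
  (∀ D → D ⊆ C → MeetsAllBases M D → D ≡ C)

_∖_ : {n : ℕ} → SetSystem n → Subset n → SetSystem n
M ∖ C = record
  { ground = ground M ─ C
  ; Indep  = λ J → ∃ λ I → Indep M I × J ≡ I ─ C }

-- Take k pairwise disjoint bases B₁ … B_k of M. Each meets the cocircuit C,
-- so the sets Bᵢ ∩ C are k disjoint nonempty subsets of C, and |C| = k forces
-- each of them to be a singleton. The sets Bᵢ ─ C are then independent in
-- M ∖ C, pairwise disjoint, and of size r(M) − 1. They are bases of M ∖ C:
-- an independent set I ─ C avoids C, so it is not a base of M (C meets every
-- base) and has size at most r(M) − 1.
module Submission where

open import Defs
open import Data.Nat using (ℕ; zero; suc; _+_; _≤_; _<_; _≤?_; z≤n; s≤s; s≤s⁻¹)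
open import Data.Nat.Properties
open import Data.Fin using (Fin; punchIn) renaming (zero to fzero; suc to fsuc)
open import Data.Fin.Properties using () renaming (suc-injective to fsuc-injective)
open import Data.Fin.Subset
  using (Subset; _∈_; _∉_; _⊆_; _∩_; _─_; ∣_∣; Nonempty; outside; inside; ⊥)
open import Data.Fin.Subset.Properties
open import Data.Vec using (_∷_; []; lookup; tabulate; here; there)
open import Data.Vec.Properties using (lookup∘tabulate)
open import Data.Vec.Functional using (Vector; tail; removeAt)
open import Algebra.Properties.CommutativeMonoid.Sum +-0-commutativeMonoid
  using (sum; sum-remove)
open import Data.Product using (_,_; proj₁)
open import Function using (_∘_)
open import Relation.Binary.PropositionalEquality
  using (_≡_; _≢_; refl; sym; trans; cong; subst)
open import Relation.Nullary using (¬_; contradiction; yes; no)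
open import Data.Sum using (inj₂)

private
  variable
    n m : ℕ
    x : Fin n
    p q p′ q′ : Subset n

x∈p─q⇒x∉q : ∀ (p q : Subset n) → x ∈ p ─ q → x ∉ q
x∈p─q⇒x∉q (inside ∷ p) (outside ∷ q) here       ()
x∈p─q⇒x∉q (_      ∷ p) (_       ∷ q) (there x∈) (there x∈q) = x∈p─q⇒x∉q p q x∈ x∈q

∣p∣≡∣p─q∣+∣p∩q∣ : ∀ (p q : Subset n) → ∣ p ∣ ≡ ∣ p ─ q ∣ + ∣ p ∩ q ∣
∣p∣≡∣p─q∣+∣p∩q∣ []            []            = refl
∣p∣≡∣p─q∣+∣p∩q∣ (outside ∷ p) (outside ∷ q) = ∣p∣≡∣p─q∣+∣p∩q∣ p q
∣p∣≡∣p─q∣+∣p∩q∣ (outside ∷ p) (inside  ∷ q) = ∣p∣≡∣p─q∣+∣p∩q∣ p q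
∣p∣≡∣p─q∣+∣p∩q∣ (inside  ∷ p) (outside ∷ q) = cong suc (∣p∣≡∣p─q∣+∣p∩q∣ p q)
∣p∣≡∣p─q∣+∣p∩q∣ (inside  ∷ p) (inside  ∷ q) =
  trans (cong suc (∣p∣≡∣p─q∣+∣p∩q∣ p q)) (sym (+-suc _ _))

p⊆q∧∣q∣≤∣p∣⇒p≡q : p ⊆ q → ∣ q ∣ ≤ ∣ p ∣ → p ≡ q
p⊆q∧∣q∣≤∣p∣⇒p≡q {p = []}          {[]}          _   _          = refl
p⊆q∧∣q∣≤∣p∣⇒p≡q {p = outside ∷ p} {outside ∷ q} p⊆q ∣q∣≤∣p∣     =
  cong (outside ∷_) (p⊆q∧∣q∣≤∣p∣⇒p≡q (drop-∷-⊆ p⊆q) ∣q∣≤∣p∣)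
p⊆q∧∣q∣≤∣p∣⇒p≡q {p = inside  ∷ p} {inside  ∷ q} p⊆q (s≤s ∣q∣≤∣p∣) =
  cong (inside ∷_) (p⊆q∧∣q∣≤∣p∣⇒p≡q (drop-∷-⊆ p⊆q) ∣q∣≤∣p∣)
p⊆q∧∣q∣≤∣p∣⇒p≡q {p = inside  ∷ p} {outside ∷ q} p⊆q _          with p⊆q here
... | ()
p⊆q∧∣q∣≤∣p∣⇒p≡q {p = outside ∷ p} {inside  ∷ q} p⊆q ∣q∣≤∣p∣     =
  contradiction (≤-trans (s≤s (p⊆q⇒∣p∣≤∣q∣ (drop-∷-⊆ p⊆q))) ∣q∣≤∣p∣) (n≮n _)

nonempty⇒∣p∣>0 : Nonempty p → 0 < ∣ p ∣
nonempty⇒∣p∣>0 (_ , x∈p) = ≤-<-trans z≤n (x∈p⇒∣p-x∣<∣p∣ x∈p)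

PairwiseDisjoint : Vector (Subset n) m → Set
PairwiseDisjoint D = ∀ i j → i ≢ j → D i ∩ D j ≡ ⊥

disjoint⇒x∈p⇒x∉q : p ∩ q ≡ ⊥ → x ∈ p → x ∉ q
disjoint⇒x∈p⇒x∉q p∩q≡⊥ x∈p x∈q = ∉⊥ (subst (_ ∈_) p∩q≡⊥ (x∈p∩q⁺ (x∈p , x∈q)))

disjoint-⊆ : p′ ⊆ p → q′ ⊆ q → p ∩ q ≡ ⊥ → p′ ∩ q′ ≡ ⊥
disjoint-⊆ {p′ = p′} {q′ = q′} p′⊆p q′⊆q p∩q≡⊥ = ⊆-antisym p′∩q′⊆⊥ ⊥⊆
  where
  p′∩q′⊆⊥ : p′ ∩ q′ ⊆ ⊥
  p′∩q′⊆⊥ x∈ = let x∈p′ , x∈q′ = x∈p∩q⁻ p′ q′ x∈ in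
    contradiction (q′⊆q x∈q′) (disjoint⇒x∈p⇒x∉q p∩q≡⊥ (p′⊆p x∈p′))

sum-∣∣≤-pairwiseDisjoint : ∀ (C : Subset n) (D : Vector (Subset n) m) →
  PairwiseDisjoint D → (∀ i → D i ⊆ C) → sum (∣_∣ ∘ D) ≤ ∣ C ∣
sum-∣∣≤-pairwiseDisjoint {m = zero}  C D _        _   = z≤n
sum-∣∣≤-pairwiseDisjoint {m = suc m} C D disjoint D⊆C = begin
  ∣ D fzero ∣ + sum (∣_∣ ∘ tail D) ≤⟨ +-mono-≤ ∣D₀∣≤∣C∩D₀∣ sum-tail≤ ⟩
  ∣ C ∩ D fzero ∣ + ∣ C ─ D fzero ∣ ≡⟨ +-comm ∣ C ∩ D fzero ∣ _ ⟩
  ∣ C ─ D fzero ∣ + ∣ C ∩ D fzero ∣ ≡⟨ ∣p∣≡∣p─q∣+∣p∩q∣ C (D fzero) ⟨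
  ∣ C ∣                             ∎
  where
  open ≤-Reasoning
  ∣D₀∣≤∣C∩D₀∣ : ∣ D fzero ∣ ≤ ∣ C ∩ D fzero ∣
  ∣D₀∣≤∣C∩D₀∣ = p⊆q⇒∣p∣≤∣q∣ (λ x∈ → x∈p∩q⁺ (D⊆C fzero x∈ , x∈))
  tail⊆C─D₀ : ∀ i → D (fsuc i) ⊆ C ─ D fzero
  tail⊆C─D₀ i x∈ = x∈p∧x∉q⇒x∈p─q (D⊆C (fsuc i) x∈)
    (λ x∈D₀ → disjoint⇒x∈p⇒x∉q (disjoint fzero (fsuc i) λ ()) x∈D₀ x∈)
  sum-tail≤ : sum (∣_∣ ∘ tail D) ≤ ∣ C ─ D fzero ∣
  sum-tail≤ = sum-∣∣≤-pairwiseDisjoint (C ─ D fzero) (tail D)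
    (λ i j i≢j → disjoint (fsuc i) (fsuc j) (i≢j ∘ fsuc-injective)) tail⊆C─D₀

length≤sum : ∀ (f : Vector ℕ m) → (∀ i → 0 < f i) → m ≤ sum f
length≤sum {m = zero}  f _   = z≤n
length≤sum {m = suc m} f pos = +-mono-≤ (pos fzero) (length≤sum (tail f) (pos ∘ fsuc))

sum≤length⇒≤1 : ∀ (f : Vector ℕ m) → (∀ i → 0 < f i) → sum f ≤ m → ∀ i → f i ≤ 1
sum≤length⇒≤1 {m = suc m} f pos sum≤ i = +-cancelʳ-≤ m (f i) 1 (begin
  f i + m                  ≤⟨ +-monoʳ-≤ (f i) (length≤sum (removeAt f i) (pos ∘ punchIn i)) ⟩
  f i + sum (removeAt f i) ≡⟨ sum-remove f ⟨
  sum f                    ≤⟨ sum≤ ⟩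
  suc m                    ∎)
  where open ≤-Reasoning

module _ {M : SetSystem n} (isMatroid : IsMatroid M) where
  open IsMatroid isMatroid

  indep≤base : ∀ {B I} → IsBase M B → Indep M I → ∣ I ∣ ≤ ∣ B ∣
  indep≤base {B} {I} (indepB , maximalB) indepI with ∣ I ∣ ≤? ∣ B ∣
  ... | yes ∣I∣≤∣B∣ = ∣I∣≤∣B∣
  ... | no ∣I∣≰∣B∣ =
    let y , _ , y∉B , indepB+y = indep-aug B I indepB indepI (≰⇒> ∣I∣≰∣B∣)
        B+y≡B = maximalB _ indepB+y (p⊆p∪q _)
    in  contradiction (subst (y ∈_) B+y≡B (x∈p∪q⁺ (inj₂ (x∈⁅x⁆ y)))) y∉B

  indep-of-base-size⇒base : ∀ {B J} → IsBase M B → Indep M J → ∣ J ∣ ≡ ∣ B ∣ → IsBase M J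
  indep-of-base-size⇒base baseB indepJ ∣J∣≡∣B∣ = indepJ , λ I indepI J⊆I →
    sym (p⊆q∧∣q∣≤∣p∣⇒p≡q J⊆I (subst (_ ≤_) (sym ∣J∣≡∣B∣) (indep≤base baseB indepI)))

  avoiding⇒<base : ∀ {C B J} → MeetsAllBases M C → IsBase M B → Indep M J →
                   (∀ {x} → x ∈ J → x ∉ C) → ∣ J ∣ < ∣ B ∣
  avoiding⇒<base meets baseB indepJ avoids = ≤∧≢⇒< (indep≤base baseB indepJ) λ ∣J∣≡∣B∣ →
    let x , x∈C∩J = meets _ (indep-of-base-size⇒base baseB indepJ ∣J∣≡∣B∣)
        x∈C , x∈J = x∈p∩q⁻ _ _ x∈C∩J
    in  avoids x∈J x∈C

  base─C-deletionBase : ∀ {C B} → MeetsAllBases M C → IsBase M B → ∣ B ∩ C ∣ ≤ 1 →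
                        IsBase (M ∖ C) (B ─ C)
  base─C-deletionBase {C} {B} meets baseB ∣B∩C∣≤1 = (B , proj₁ baseB , refl) , maximal
    where
    maximal : ∀ J → Indep (M ∖ C) J → B ─ C ⊆ J → J ≡ B ─ C
    maximal _ (I , indepI , refl) B─C⊆I─C = sym (p⊆q∧∣q∣≤∣p∣⇒p≡q B─C⊆I─C (s≤s⁻¹ (begin
      suc ∣ I ─ C ∣             ≤⟨ avoiding⇒<base meets baseB indepI─C (x∈p─q⇒x∉q I C) ⟩
      ∣ B ∣                     ≡⟨ ∣p∣≡∣p─q∣+∣p∩q∣ B C ⟩
      ∣ B ─ C ∣ + ∣ B ∩ C ∣     ≤⟨ +-monoʳ-≤ ∣ B ─ C ∣ ∣B∩C∣≤1 ⟩
      ∣ B ─ C ∣ + 1             ≡⟨ +-comm ∣ B ─ C ∣ 1 ⟩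
      suc ∣ B ─ C ∣             ∎)))
      where
      open ≤-Reasoning
      indepI─C : Indep M (I ─ C)
      indepI─C = indep-hered (I ─ C) I indepI (p─q⊆p I C)

hasDisjointBases : ∀ (M : SetSystem n) (B : Vector (Subset n) m) →
  (∀ i → IsBase M (B i)) → PairwiseDisjoint B → HasDisjointBases M m
hasDisjointBases M B bases disjoint = tabulate B , base , disjoint′
  where
  base : ∀ i → IsBase M (lookup (tabulate B) i)
  base i rewrite lookup∘tabulate B i = bases i
  disjoint′ : PairwiseDisjoint (lookup (tabulate B))
  disjoint′ i j i≢j rewrite lookup∘tabulate B i | lookup∘tabulate B j = disjoint i j i≢j

lemma1p8 : (n : ℕ) (M : Matroid n) (k : ℕ) → σ≡ (system M) k →
           (C : Subset n) → IsCocircuit (system M) C → ∣ C ∣ ≡ k →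
           ¬ (C ≡ ground (system M)) →
           σ≥ (system M ∖ C) k
lemma1p8 n M k ((Bs , bases , disjoint) , _) C (_ , meets , _) ∣C∣≡k _ =
  k , ≤-refl , hasDisjointBases (system M ∖ C) (λ i → B i ─ C)
    (λ i → base─C-deletionBase (isMatroid M) meets (bases i) (∣B∩C∣≤1 i))
    (λ i j i≢j → disjoint-⊆ (p─q⊆p _ _) (p─q⊆p _ _) (disjoint i j i≢j))
  where
  B : Vector (Subset n) k
  B = lookup Bs
  B∩C⊆C : ∀ i → B i ∩ C ⊆ C
  B∩C⊆C i = p∩q⊆q (B i) C
  B∩C-disjoint : PairwiseDisjoint (λ i → B i ∩ C)
  B∩C-disjoint i j i≢j = disjoint-⊆ (p∩q⊆p _ _) (p∩q⊆p _ _) (disjoint i j i≢j)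
  ∣B∩C∣>0 : ∀ i → 0 < ∣ B i ∩ C ∣
  ∣B∩C∣>0 i = nonempty⇒∣p∣>0 (subst Nonempty (∩-comm C (B i)) (meets (B i) (bases i)))
  ∣B∩C∣≤1 : ∀ i → ∣ B i ∩ C ∣ ≤ 1
  ∣B∩C∣≤1 = sum≤length⇒≤1 (λ i → ∣ B i ∩ C ∣) ∣B∩C∣>0
    (subst (sum (λ i → ∣ B i ∩ C ∣) ≤_) ∣C∣≡k
      (sum-∣∣≤-pairwiseDisjoint C (λ i → B i ∩ C) B∩C-disjoint B∩C⊆C))
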